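{- There is a sufficiently small absolute constant $c>0$ such that the following holds for all $k\le\ell\le cn$. Suppose $\mathcal{A}$ is an algorithm which, given $q$ independent uniformly random examples $(x,f(x))$, $x\sim\{0,1\}^n$, labeled by any monotone function $f:\{0,1\}^n\to\{0,1\}$ with $C(f)\le k$, and any input $x^\star\in\{0,1\}^n$, returns a certificate of size $\ell$ for $f$'s value on $x^\star$ with high probability. Then $q=\Omega(2^k)$.
   Context: A set $S\subseteq[n]$ is a certificate for $f$'s value on $x$ if $f(y)=f(x)$ for all $y$ agreeing with $x$ on $S$; $C(f)$ is the maximum over $x$ of the minimum size of such a certificate. $f$ is monotone if $x\le y$ coordinatewise implies $f(x)\le f(y)$. "With high probability" means with probability at least $1-1/\mathrm{poly}(n)$. -}

module Defs where

open import Data.Nat as ℕ using (ℕ; zero; suc; _+_; _*_; _^_; _≤_; _≤?_)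
open import Data.Bool as 𝔹 using (Bool; true; false)
open import Data.Bool.Properties as 𝔹P using ()
open import Data.Fin using (Fin)
open import Data.Fin.Properties using (all?)
open import Data.Fin.Subset using (Subset; _∈_; ∣_∣)
open import Data.Fin.Subset.Properties using (_∈?_)
open import Data.Vec using (Vec; []; _∷_; lookup)
import Data.Vec as Vec
open import Data.Vec.Relation.Binary.Pointwise.Inductive using (Pointwise)
open import Data.List using (List; []; _∷_; _++_; map; filter; length; cartesianProduct; allFin)
open import Data.List.Membership.Propositional using () renaming (_∈_ to _∈ₗ_)
open import Data.List.Membership.Propositional.Properties using (∈-++⁺ˡ; ∈-++⁺ʳ; ∈-map⁺)
open import Data.List.Relation.Unary.All using (All)
  renaming (lookup to lookupAll; all? to allL?)
open import Data.List.Relation.Unary.Any using (here)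
open import Data.Product using (Σ; ∃; _×_; _,_)
open import Relation.Nullary using (Dec; ¬_; map′)
open import Relation.Nullary.Decidable using (_→-dec_; _×-dec_; ¬?)
open import Relation.Binary.PropositionalEquality using (_≡_; refl)

Cube : ℕ → Set
Cube n = Vec Bool n

BoolFun : ℕ → Set
BoolFun n = Cube n → Bool

_≤ᶜ_ : ∀ {n} → Cube n → Cube n → Set
x ≤ᶜ y = Pointwise 𝔹._≤_ x y

Monotone : ∀ {n} → BoolFun n → Set
Monotone {n} f = ∀ (x y : Cube n) → x ≤ᶜ y → f x 𝔹.≤ f y

AgreeOn : ∀ {n} → Subset n → Cube n → Cube n → Set
AgreeOn S x y = ∀ i → i ∈ S → lookup y i ≡ lookup x i

IsCertificate : ∀ {n} → BoolFun n → Cube n → Subset n → Set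
IsCertificate {n} f x S = ∀ (y : Cube n) → AgreeOn S x y → f y ≡ f x

CertComplexity≤ : ∀ {n} → BoolFun n → ℕ → Set
CertComplexity≤ {n} f k = ∀ (x : Cube n) → ∃ λ S → ∣ S ∣ ≤ k × IsCertificate f x S

allCube : ∀ n → List (Cube n)
allCube zero = [] ∷ []
allCube (suc n) = map (true ∷_) (allCube n) ++ map (false ∷_) (allCube n)

allCube-complete : ∀ {n} (x : Cube n) → x ∈ₗ allCube n
allCube-complete [] = here refl
allCube-complete {suc n} (true ∷ x) = ∈-++⁺ˡ (∈-map⁺ (true ∷_) (allCube-complete x))
allCube-complete {suc n} (false ∷ x) =
  ∈-++⁺ʳ (map (true ∷_) (allCube n)) (∈-map⁺ (false ∷_) (allCube-complete x))

allSeq : ∀ n q → List (Vec (Cube n) q)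
allSeq n zero = [] ∷ []
allSeq n (suc q) = Data.List.concatMap (λ x → map (x ∷_) (allSeq n q)) (allCube n)

agree? : ∀ {n} (S : Subset n) (x y : Cube n) → Dec (AgreeOn S x y)
agree? S x y = all? (λ i → (i ∈? S) →-dec (lookup y i 𝔹P.≟ lookup x i))

isCertificate? : ∀ {n} (f : BoolFun n) (x : Cube n) (S : Subset n) → Dec (IsCertificate f x S)
isCertificate? {n} f x S =
  map′ (λ a y → lookupAll a (allCube-complete y)) (λ h → Data.List.Relation.Unary.All.tabulate (λ {y} _ → h y))
       (allL? (λ y → agree? S x y →-dec (f y 𝔹P.≟ f x)) (allCube n))

-- A (randomized) certificate-finding algorithm with q labelled examples and
-- m equally likely internal random seeds: given the examples (x_i, f(x_i)),
-- the input x⋆ and a seed, it outputs a set of coordinates.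
Algorithm : ℕ → ℕ → ℕ → Set
Algorithm n q m = Vec (Cube n × Bool) q → Cube n → Fin m → Subset n

Succeeds : ∀ {n q m} → Algorithm n q m → BoolFun n → ℕ → Cube n →
           Vec (Cube n) q × Fin m → Set
Succeeds A f ℓ x⋆ (xs , r) =
  let S = A (Vec.map (λ x → x , f x) xs) x⋆ r in ∣ S ∣ ≤ ℓ × IsCertificate f x⋆ S

succeeds? : ∀ {n q m} (A : Algorithm n q m) f ℓ x⋆ ω → Dec (Succeeds A f ℓ x⋆ ω)
succeeds? A f ℓ x⋆ (xs , r) =
  let S = A (Vec.map (λ x → x , f x) xs) x⋆ r in (∣ S ∣ ≤? ℓ) ×-dec isCertificate? f x⋆ S

-- Number of outcomes (example sequence x_1..x_q uniform in ({0,1}^n)^q, seed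
-- uniform in Fin m) on which the algorithm fails.  The total number of
-- equally likely outcomes is (2^n)^q * m.
failures : ∀ {n q m} → Algorithm n q m → BoolFun n → ℕ → Cube n → ℕ
failures {n} {q} {m} A f ℓ x⋆ =
  length (filter (λ ω → ¬? (succeeds? A f ℓ x⋆ ω)) (cartesianProduct (allSeq n q) (allFin m)))

-- Failure probability ≤ 1 / n^a, i.e. failures * n^a ≤ (2^n)^q * m.
FailProb≤InvPow : ∀ {n q m} → Algorithm n q m → BoolFun n → ℕ → Cube n → ℕ → Set
FailProb≤InvPow {n} {q} {m} A f ℓ x⋆ a = failures A f ℓ x⋆ * n ^ a ≤ (2 ^ n) ^ q * m

-- Consider AND_T for the n − k + 1 sets T = {0,…,k−2} ∪ {j} and the input x⋆ = 1. A certificate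
-- for AND_T on 1 must contain T, and a set of size ℓ contains at most ℓ of these T. With q < 2^k/4
-- examples, with probability ≥ 3/4 none of them lies in the subcube where AND_T = 1; then all labels
-- are 0 and the output does not depend on T. Averaged over T, that output certifies AND_T with
-- probability at most ℓ/(n − k + 1) < 1/2, so for some T the algorithm fails with probability
-- ≥ 1/4 > n^(−a).
{-# OPTIONS --safe #-}
module Submission where

open import Defs
open import Data.Bool using (Bool; true; false; _∧_; _∨_)
import Data.Bool as 𝔹
open import Data.Bool.Properties using (∧-identityʳ; ∧-zeroʳ; ≤-minimum; T-≡)
open import Data.Empty using (⊥-elim)
open import Data.Fin using (Fin)
import Data.Fin as Fin
open import Data.Fin.Subset using (Subset; ∣_∣) renaming (⊥ to ∅)
open import Data.Fin.Subset.Properties using (∣⊥∣≡0)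
open import Data.List using (List; []; _∷_; _++_; map; filter; length; cartesianProduct; allFin; concatMap)
open import Data.List.Properties using (length-++; length-map; length-tabulate)
open import Data.List.Relation.Unary.All as All using (All; []; _∷_)
open import Data.List.Relation.Unary.All.Properties using (map⁺)
open import Data.Nat using (ℕ; zero; suc; _+_; _*_; _^_; _≤_; _<_; z≤n; s≤s; _≤ᵇ_; _≤?_; NonZero; >-nonZero)
open import Data.Nat.Properties
open import Data.Nat.Tactic.RingSolver using (solve-∀)
open import Data.Product using (∃; _×_; _,_; proj₁; proj₂)
open import Data.Vec using (Vec; []; _∷_; replicate; here; there)
import Data.Vec as Vec
open import Data.Vec.Properties using ([]=⇒lookup; lookup-replicate)
open import Data.Vec.Relation.Binary.Pointwise.Inductive using ([]; _∷_)
open import Function.Bundles using (Equivalence)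
open import Relation.Nullary using (yes; no; ¬_)
open import Relation.Nullary.Decidable using (¬?)
open import Relation.Unary using (Decidable)
open import Relation.Binary.PropositionalEquality

private
  variable
    A B : Set

indicator : Bool → ℕ
indicator true  = 1
indicator false = 0

count : (A → Bool) → List A → ℕ
count g []       = 0
count g (x ∷ xs) = indicator (g x) + count g xs

sumOver : List A → (A → ℕ) → ℕ
sumOver []       f = 0
sumOver (x ∷ xs) f = f x + sumOver xs f

count-++ : ∀ (g : A → Bool) xs ys → count g (xs ++ ys) ≡ count g xs + count g ys
count-++ g []       ys = refl
count-++ g (x ∷ xs) ys =
  trans (cong (indicator (g x) +_) (count-++ g xs ys)) (sym (+-assoc (indicator (g x)) _ _))

count-map : ∀ (g : B → Bool) (h : A → B) xs → count g (map h xs) ≡ count (λ x → g (h x)) xs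
count-map g h []       = refl
count-map g h (x ∷ xs) = cong (indicator (g (h x)) +_) (count-map g h xs)

count-cong : ∀ {g h : A → Bool} → (∀ x → g x ≡ h x) → ∀ xs → count g xs ≡ count h xs
count-cong g≗h []       = refl
count-cong g≗h (x ∷ xs) = cong₂ _+_ (cong indicator (g≗h x)) (count-cong g≗h xs)

count-true : ∀ (xs : List A) → count (λ _ → true) xs ≡ length xs
count-true []       = refl
count-true (x ∷ xs) = cong suc (count-true xs)

count-false : ∀ (xs : List A) → count (λ _ → false) xs ≡ 0
count-false []       = refl
count-false (x ∷ xs) = count-false xs

count-const : ∀ b (xs : List A) → count (λ _ → b) xs ≡ indicator b * length xs
count-const true  xs = trans (count-true xs) (sym (*-identityˡ _))
count-const false xs = count-false xs

count-∨ : ∀ (g h : A → Bool) xs → count (λ x → g x ∨ h x) xs ≤ count g xs + count h xs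
count-∨ g h []       = z≤n
count-∨ g h (x ∷ xs) with g x | h x | count-∨ g h xs
... | true  | true  | ih = s≤s (≤-trans ih (+-monoʳ-≤ (count g xs) (n≤1+n _)))
... | true  | false | ih = s≤s ih
... | false | true  | ih = ≤-trans (s≤s ih) (≤-reflexive (sym (+-suc _ _)))
... | false | false | ih = ih

length≤count+filter : ∀ {P : A → Set} (P? : Decidable P) (g : A → Bool) →
  (∀ x → g x ≡ false → P x) → ∀ xs → length xs ≤ count g xs + length (filter P? xs)
length≤count+filter P? g unmarked⇒P [] = z≤n
length≤count+filter P? g unmarked⇒P (x ∷ xs) with g x in gx | P? x
... | true  | yes _ = s≤s (≤-trans ih (+-monoʳ-≤ (count g xs) (n≤1+n _)))
  where ih = length≤count+filter P? g unmarked⇒P xs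
... | true  | no _  = s≤s (length≤count+filter P? g unmarked⇒P xs)
... | false | yes _ =
  ≤-trans (s≤s (length≤count+filter P? g unmarked⇒P xs)) (≤-reflexive (sym (+-suc _ _)))
... | false | no ¬Px = ⊥-elim (¬Px (unmarked⇒P x gx))

count-concatMap : ∀ (g : B → Bool) (f : A → List B) xs →
  count g (concatMap f xs) ≡ sumOver xs (λ x → count g (f x))
count-concatMap g f []       = refl
count-concatMap g f (x ∷ xs) =
  trans (count-++ g (f x) (concatMap f xs)) (cong (count g (f x) +_) (count-concatMap g f xs))

count-cartesianProduct : ∀ (g : A → Bool) xs (ys : List B) →
  count (λ w → g (proj₁ w)) (cartesianProduct xs ys) ≡ count g xs * length ys
count-cartesianProduct g []       ys = refl
count-cartesianProduct g (x ∷ xs) ys = begin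
    count (λ w → g (proj₁ w)) (map (x ,_) ys ++ cartesianProduct xs ys)
  ≡⟨ count-++ (λ w → g (proj₁ w)) (map (x ,_) ys) (cartesianProduct xs ys) ⟩
    count (λ w → g (proj₁ w)) (map (x ,_) ys) + count (λ w → g (proj₁ w)) (cartesianProduct xs ys)
  ≡⟨ cong₂ _+_ (trans (count-map (λ w → g (proj₁ w)) (x ,_) ys) (count-const (g x) ys))
               (count-cartesianProduct g xs ys) ⟩
    indicator (g x) * length ys + count g xs * length ys
  ≡⟨ sym (*-distribʳ-+ (length ys) (indicator (g x)) _) ⟩
    (indicator (g x) + count g xs) * length ys
  ∎
  where open ≡-Reasoning

length-cartesianProduct : ∀ (xs : List A) (ys : List B) →
  length (cartesianProduct xs ys) ≡ length xs * length ys
length-cartesianProduct xs ys = begin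
  length (cartesianProduct xs ys)              ≡⟨ count-true (cartesianProduct xs ys) ⟨
  count (λ _ → true) (cartesianProduct xs ys) ≡⟨ count-cartesianProduct (λ _ → true) xs ys ⟩
  count (λ _ → true) xs * length ys           ≡⟨ cong (_* length ys) (count-true xs) ⟩
  length xs * length ys                        ∎
  where open ≡-Reasoning

sum-+ : ∀ xs (f g : A → ℕ) → sumOver xs (λ x → f x + g x) ≡ sumOver xs f + sumOver xs g
sum-+ []       f g = refl
sum-+ (x ∷ xs) f g = trans (cong (f x + g x +_) (sum-+ xs f g)) (interchange (f x) (g x) _ _)
  where
  interchange : ∀ a b c d → a + b + (c + d) ≡ a + c + (b + d)
  interchange = solve-∀

sum-const : ∀ (xs : List A) c → sumOver xs (λ _ → c) ≡ length xs * c
sum-const []       c = refl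
sum-const (x ∷ xs) c = cong (c +_) (sum-const xs c)

sum-*ˡ : ∀ (xs : List A) c f → sumOver xs (λ x → c * f x) ≡ c * sumOver xs f
sum-*ˡ []       c f = sym (*-zeroʳ c)
sum-*ˡ (x ∷ xs) c f = trans (cong (c * f x +_) (sum-*ˡ xs c f)) (sym (*-distribˡ-+ c (f x) _))

sum-indicator : ∀ (xs : List A) g → sumOver xs (λ x → indicator (g x)) ≡ count g xs
sum-indicator []       g = refl
sum-indicator (x ∷ xs) g = cong (indicator (g x) +_) (sum-indicator xs g)

sum-mono-≤ : ∀ (xs : List A) {f g} → All (λ x → f x ≤ g x) xs → sumOver xs f ≤ sumOver xs g
sum-mono-≤ []       []         = z≤n
sum-mono-≤ (x ∷ xs) (fx≤gx ∷ p) = +-mono-≤ fx≤gx (sum-mono-≤ xs p)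

sum-count-comm : ∀ (xs : List A) (ys : List B) (h : A → B → Bool) →
  sumOver xs (λ x → count (h x) ys) ≡ sumOver ys (λ y → count (λ x → h x y) xs)
sum-count-comm xs []       h = trans (sum-const xs 0) (*-zeroʳ (length xs))
sum-count-comm xs (y ∷ ys) h = begin
    sumOver xs (λ x → indicator (h x y) + count (h x) ys)
  ≡⟨ sum-+ xs _ _ ⟩
    sumOver xs (λ x → indicator (h x y)) + sumOver xs (λ x → count (h x) ys)
  ≡⟨ cong₂ _+_ (sum-indicator xs (λ x → h x y)) (sum-count-comm xs ys h) ⟩
    count (λ x → h x y) xs + sumOver ys (λ y → count (λ x → h x y) xs)
  ∎
  where open ≡-Reasoning

length-allCube : ∀ n → length (allCube n) ≡ 2 ^ n
length-allCube zero    = refl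
length-allCube (suc n) = begin
    length (map (true ∷_) (allCube n) ++ map (false ∷_) (allCube n))
  ≡⟨ length-++ (map (true ∷_) (allCube n)) ⟩
    length (map (true ∷_) (allCube n)) + length (map (false ∷_) (allCube n))
  ≡⟨ cong₂ _+_ (length-map (true ∷_) (allCube n)) (length-map (false ∷_) (allCube n)) ⟩
    length (allCube n) + length (allCube n)
  ≡⟨ cong (λ c → c + c) (length-allCube n) ⟩
    2 ^ n + 2 ^ n
  ≡⟨ cong (2 ^ n +_) (+-identityʳ (2 ^ n)) ⟨
    2 * 2 ^ n
  ∎
  where open ≡-Reasoning

count-allCube-suc : ∀ n (g : Cube (suc n) → Bool) →
  count g (allCube (suc n)) ≡ count (λ x → g (true ∷ x)) (allCube n) + count (λ x → g (false ∷ x)) (allCube n)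
count-allCube-suc n g =
  trans (count-++ g (map (true ∷_) (allCube n)) (map (false ∷_) (allCube n)))
        (cong₂ _+_ (count-map g (true ∷_) (allCube n)) (count-map g (false ∷_) (allCube n)))

length-allSeq : ∀ n q → length (allSeq n q) ≡ (2 ^ n) ^ q
length-allSeq n zero    = refl
length-allSeq n (suc q) =
  trans (length-prepend-each (allCube n)) (cong₂ _*_ (length-allCube n) (length-allSeq n q))
  where
  length-prepend-each : ∀ xs → length (concatMap (λ x → map (x ∷_) (allSeq n q)) xs) ≡ length xs * length (allSeq n q)
  length-prepend-each []       = refl
  length-prepend-each (x ∷ xs) =
    trans (length-++ (map (x ∷_) (allSeq n q)))
          (cong₂ _+_ (length-map (x ∷_) (allSeq n q)) (length-prepend-each xs))

ones : ∀ n → Cube n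
ones n = replicate n true

-- Subsets and points of the cube are both Vec Bool n: for a set S, andOn T S ≡ true says T ⊆ S.
andOn : ∀ {n} → Subset n → BoolFun n
andOn []           []       = true
andOn (true  ∷ T) (x ∷ xs) = x ∧ andOn T xs
andOn (false ∷ T) (_ ∷ xs) = andOn T xs

anyAndOn : ∀ {n q} → Subset n → Vec (Cube n) q → Bool
anyAndOn T []       = false
anyAndOn T (x ∷ xs) = andOn T x ∨ anyAndOn T xs

andOn-∅ : ∀ {n} (x : Cube n) → andOn ∅ x ≡ true
andOn-∅ []       = refl
andOn-∅ (_ ∷ x) = andOn-∅ x

andOn-ones : ∀ {n} (T : Subset n) → andOn T (ones n) ≡ true
andOn-ones []          = refl
andOn-ones (true  ∷ T) = andOn-ones T
andOn-ones (false ∷ T) = andOn-ones T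

andOn-monotone : ∀ {n} (T : Subset n) → Monotone (andOn T)
andOn-monotone []          []          []          []              = 𝔹.b≤b
andOn-monotone (true  ∷ T) (true  ∷ x) (true  ∷ y) (𝔹.b≤b ∷ x≤y) = andOn-monotone T x y x≤y
andOn-monotone (true  ∷ T) (false ∷ x) (false ∷ y) (𝔹.b≤b ∷ x≤y) = 𝔹.b≤b
andOn-monotone (true  ∷ T) (false ∷ x) (true  ∷ y) (𝔹.f≤t ∷ x≤y) = ≤-minimum (andOn T y)
andOn-monotone (false ∷ T) (_ ∷ x)     (_ ∷ y)     (_ ∷ x≤y)      = andOn-monotone T x y x≤y

andOn-agree : ∀ {n} (T : Subset n) x y → AgreeOn T x y → andOn T y ≡ andOn T x
andOn-agree []          []      []      agree = refl
andOn-agree (true  ∷ T) (_ ∷ x) (_ ∷ y) agree =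
  cong₂ _∧_ (agree Fin.zero here) (andOn-agree T x y (λ i i∈T → agree (Fin.suc i) (there i∈T)))
andOn-agree (false ∷ T) (_ ∷ x) (_ ∷ y) agree =
  andOn-agree T x y (λ i i∈T → agree (Fin.suc i) (there i∈T))

andOn-certComplexity : ∀ {n k} (T : Subset n) → ∣ T ∣ ≡ k → CertComplexity≤ (andOn T) k
andOn-certComplexity T ∣T∣≡k x = T , ≤-reflexive ∣T∣≡k , λ y → andOn-agree T x y

certificate-of-ones : ∀ {n} (T S : Subset n) → IsCertificate (andOn T) (ones n) S → andOn T S ≡ true
certificate-of-ones {n} T S cert = trans (cert S S-agrees) (andOn-ones T)
  where
  S-agrees : AgreeOn S (ones n) S
  S-agrees i i∈S = trans ([]=⇒lookup i∈S) (sym (lookup-replicate i true))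

count-andOn : ∀ {n} (T : Subset n) → count (andOn T) (allCube n) * 2 ^ ∣ T ∣ ≡ 2 ^ n
count-andOn {zero}  []          = refl
count-andOn {suc n} (true ∷ T)  = begin
    count (andOn (true ∷ T)) (allCube (suc n)) * (2 * 2 ^ ∣ T ∣)
  ≡⟨ cong (_* (2 * 2 ^ ∣ T ∣)) (count-allCube-suc n (andOn (true ∷ T))) ⟩
    (count (andOn T) (allCube n) + count (λ _ → false) (allCube n)) * (2 * 2 ^ ∣ T ∣)
  ≡⟨ cong (λ c → (count (andOn T) (allCube n) + c) * (2 * 2 ^ ∣ T ∣)) (count-false (allCube n)) ⟩
    (count (andOn T) (allCube n) + 0) * (2 * 2 ^ ∣ T ∣)
  ≡⟨ double (count (andOn T) (allCube n)) (2 ^ ∣ T ∣) ⟩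
    2 * (count (andOn T) (allCube n) * 2 ^ ∣ T ∣)
  ≡⟨ cong (2 *_) (count-andOn T) ⟩
    2 * 2 ^ n
  ∎
  where
  open ≡-Reasoning
  double : ∀ a b → (a + 0) * (2 * b) ≡ 2 * (a * b)
  double = solve-∀
count-andOn {suc n} (false ∷ T) = begin
    count (andOn (false ∷ T)) (allCube (suc n)) * 2 ^ ∣ T ∣
  ≡⟨ cong (_* 2 ^ ∣ T ∣) (count-allCube-suc n (andOn (false ∷ T))) ⟩
    (count (andOn T) (allCube n) + count (andOn T) (allCube n)) * 2 ^ ∣ T ∣
  ≡⟨ double (count (andOn T) (allCube n)) (2 ^ ∣ T ∣) ⟩
    2 * (count (andOn T) (allCube n) * 2 ^ ∣ T ∣)
  ≡⟨ cong (2 *_) (count-andOn T) ⟩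
    2 * 2 ^ n
  ∎
  where
  open ≡-Reasoning
  double : ∀ a b → (a + a) * b ≡ 2 * (a * b)
  double = solve-∀

count-anyAndOn : ∀ n q (T : Subset n) → count (anyAndOn T) (allSeq n q) * 2 ^ ∣ T ∣ ≤ q * (2 ^ n) ^ q
count-anyAndOn n zero    T = z≤n
count-anyAndOn n (suc q) T = begin
    count (anyAndOn T) (allSeq n (suc q)) * K
  ≤⟨ *-monoˡ-≤ K first-or-rest ⟩
    (P * a + 2 ^ n * c) * K
  ≡⟨ regroup P a (2 ^ n) c K ⟩
    a * K * P + 2 ^ n * (c * K)
  ≤⟨ +-monoʳ-≤ (a * K * P) (*-monoʳ-≤ (2 ^ n) (count-anyAndOn n q T)) ⟩
    a * K * P + 2 ^ n * (q * P)
  ≡⟨ cong (λ z → z * P + 2 ^ n * (q * P)) (count-andOn T) ⟩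
    2 ^ n * P + 2 ^ n * (q * P)
  ≡⟨ collect (2 ^ n) P q ⟩
    suc q * (2 ^ n * P)
  ∎
  where
  open ≤-Reasoning
  K = 2 ^ ∣ T ∣
  P = (2 ^ n) ^ q
  a = count (andOn T) (allCube n)
  c = count (anyAndOn T) (allSeq n q)

  prepend : ∀ x → count (anyAndOn T) (map (x ∷_) (allSeq n q)) ≤ P * indicator (andOn T x) + c
  prepend x = begin
      count (anyAndOn T) (map (x ∷_) (allSeq n q))
    ≡⟨ count-map (anyAndOn T) (x ∷_) (allSeq n q) ⟩
      count (λ xs → andOn T x ∨ anyAndOn T xs) (allSeq n q)
    ≤⟨ count-∨ (λ _ → andOn T x) (anyAndOn T) (allSeq n q) ⟩
      count (λ _ → andOn T x) (allSeq n q) + c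
    ≡⟨ cong (_+ c) (trans (count-const (andOn T x) (allSeq n q))
                          (trans (cong (indicator (andOn T x) *_) (length-allSeq n q))
                                 (*-comm (indicator (andOn T x)) P))) ⟩
      P * indicator (andOn T x) + c
    ∎

  first-or-rest : count (anyAndOn T) (allSeq n (suc q)) ≤ P * a + 2 ^ n * c
  first-or-rest = begin
      count (anyAndOn T) (allSeq n (suc q))
    ≡⟨ count-concatMap (anyAndOn T) (λ x → map (x ∷_) (allSeq n q)) (allCube n) ⟩
      sumOver (allCube n) (λ x → count (anyAndOn T) (map (x ∷_) (allSeq n q)))
    ≤⟨ sum-mono-≤ (allCube n) (All.tabulate (λ {x} _ → prepend x)) ⟩
      sumOver (allCube n) (λ x → P * indicator (andOn T x) + c)
    ≡⟨ sum-+ (allCube n) _ _ ⟩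
      sumOver (allCube n) (λ x → P * indicator (andOn T x)) + sumOver (allCube n) (λ _ → c)
    ≡⟨ cong₂ _+_ (trans (sum-*ˡ (allCube n) P _) (cong (P *_) (sum-indicator (allCube n) (andOn T))))
                 (trans (sum-const (allCube n) c) (cong (_* c) (length-allCube n))) ⟩
      P * a + 2 ^ n * c
    ∎

  regroup : ∀ P a X c K → (P * a + X * c) * K ≡ a * K * P + X * (c * K)
  regroup = solve-∀
  collect : ∀ X P q → X * P + X * (q * P) ≡ (1 + q) * (X * P)
  collect = solve-∀

labels-unseen : ∀ {n q} (T : Subset n) (xs : Vec (Cube n) q) → anyAndOn T xs ≡ false →
  Vec.map (λ x → x , andOn T x) xs ≡ Vec.map (λ x → x , false) xs
labels-unseen T []       unseen = refl
labels-unseen T (x ∷ xs) unseen with andOn T x | anyAndOn T xs in rest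
labels-unseen T (x ∷ xs) refl | false | false = cong ((x , false) ∷_) (labels-unseen T xs rest)

-- sunflower b n lists the sets {0,…,b-1} ∪ {j} for b ≤ j < n.
singletons : ∀ n → List (Subset n)
singletons zero    = []
singletons (suc n) = (true ∷ ∅) ∷ map (false ∷_) (singletons n)

sunflower : ℕ → ∀ n → List (Subset n)
sunflower zero    n       = singletons n
sunflower (suc b) zero    = []
sunflower (suc b) (suc n) = map (true ∷_) (sunflower b n)

sunflower-size : ∀ b n → All (λ T → ∣ T ∣ ≡ suc b) (sunflower b n)
sunflower-size zero    n       = singletons-size n
  where
  singletons-size : ∀ n → All (λ T → ∣ T ∣ ≡ 1) (singletons n)
  singletons-size zero    = []
  singletons-size (suc n) = cong suc (∣⊥∣≡0 n) ∷ map⁺ (singletons-size n)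
sunflower-size (suc b) zero    = []
sunflower-size (suc b) (suc n) = map⁺ (All.map (cong suc) (sunflower-size b n))

sunflower-length : ∀ b n → n ≤ length (sunflower b n) + b
sunflower-length zero    n       = ≤-reflexive (sym (trans (+-identityʳ _) (length-singletons n)))
  where
  length-singletons : ∀ n → length (singletons n) ≡ n
  length-singletons zero    = refl
  length-singletons (suc n) = cong suc (trans (length-map (false ∷_) (singletons n)) (length-singletons n))
sunflower-length (suc b) zero    = z≤n
sunflower-length (suc b) (suc n) = begin
  suc n                                          ≤⟨ s≤s (sunflower-length b n) ⟩
  suc (length (sunflower b n) + b)               ≡⟨ +-suc _ b ⟨
  length (sunflower b n) + suc b                 ≡⟨ cong (_+ suc b) (length-map (true ∷_) (sunflower b n)) ⟨
  length (map (true ∷_) (sunflower b n)) + suc b ∎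
  where open ≤-Reasoning

sunflower-sparse : ∀ b n (S : Subset n) → count (λ T → andOn T S) (sunflower b n) ≤ ∣ S ∣
sunflower-sparse zero    n       S           = ≤-reflexive (count-singletons n S)
  where
  count-singletons : ∀ n (S : Subset n) → count (λ T → andOn T S) (singletons n) ≡ ∣ S ∣
  count-singletons zero    []          = refl
  count-singletons (suc n) (true  ∷ S) =
    cong₂ _+_ (cong indicator (andOn-∅ S))
              (trans (count-map (λ T → andOn T (true ∷ S)) (false ∷_) (singletons n)) (count-singletons n S))
  count-singletons (suc n) (false ∷ S) =
    trans (count-map (λ T → andOn T (false ∷ S)) (false ∷_) (singletons n)) (count-singletons n S)
sunflower-sparse (suc b) zero    []          = z≤n
sunflower-sparse (suc b) (suc n) (true  ∷ S) = begin
  count (λ T → andOn T (true ∷ S)) (map (true ∷_) (sunflower b n)) ≡⟨ count-map _ (true ∷_) (sunflower b n) ⟩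
  count (λ T → andOn T S) (sunflower b n)                          ≤⟨ sunflower-sparse b n S ⟩
  ∣ S ∣                                                            ≤⟨ n≤1+n _ ⟩
  suc ∣ S ∣                                                        ∎
  where open ≤-Reasoning
sunflower-sparse (suc b) (suc n) (false ∷ S) = ≤-trans (≤-reflexive core-missing) z≤n
  where
  core-missing : count (λ T → andOn T (false ∷ S)) (map (true ∷_) (sunflower b n)) ≡ 0
  core-missing = trans (count-map _ (true ∷_) (sunflower b n)) (count-false (sunflower b n))

sunflower-large : ∀ {b ℓ} n → b < ℓ → ℓ * 4 ≤ n → 2 * ℓ < length (sunflower b n)
sunflower-large {b} {ℓ} n b<ℓ 4ℓ≤n = +-cancelʳ-≤ ℓ (suc (2 * ℓ)) (length F) (begin
  suc (2 * ℓ) + ℓ     ≤⟨ m≤m+n _ ℓ ⟩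
  suc (2 * ℓ) + ℓ + ℓ ≡⟨ four-ℓ ℓ ⟩
  suc (ℓ * 4)         ≤⟨ s≤s (≤-trans 4ℓ≤n (sunflower-length b n)) ⟩
  suc (length F + b)  ≡⟨ +-suc _ b ⟨
  length F + suc b    ≤⟨ +-monoʳ-≤ (length F) b<ℓ ⟩
  length F + ℓ        ∎)
  where
  open ≤-Reasoning
  F = sunflower b n
  four-ℓ : ∀ ℓ → suc (2 * ℓ) + ℓ + ℓ ≡ suc (ℓ * 4)
  four-ℓ = solve-∀

quarter-of-scaled : ∀ {X c q U} → X * c ≤ q * U → 4 * q < c → 4 * X ≤ U
quarter-of-scaled {X} {c} {q} {U} Xc≤qU 4q<c = *-cancelʳ-≤ (4 * X) U (suc (4 * q)) (begin
  4 * X * suc (4 * q) ≤⟨ *-monoʳ-≤ (4 * X) 4q<c ⟩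
  4 * X * c           ≡⟨ *-assoc 4 X c ⟩
  4 * (X * c)         ≤⟨ *-monoʳ-≤ 4 Xc≤qU ⟩
  4 * (q * U)         ≡⟨ *-assoc 4 q U ⟨
  4 * q * U           ≤⟨ *-monoˡ-≤ U (n≤1+n (4 * q)) ⟩
  suc (4 * q) * U     ≡⟨ *-comm (suc (4 * q)) U ⟩
  U * suc (4 * q)     ∎)
  where open ≤-Reasoning

averaging-bound : ∀ {N U ℓ C Y Z} .{{_ : NonZero U}} →
  N * U ≤ C + Y + Z → C ≤ U * ℓ → 4 * Y ≤ N * U → 4 * Z ≤ N * U → N ≤ 2 * ℓ
averaging-bound {N} {U} {ℓ} {C} {Y} {Z} total C≤Uℓ 4Y≤NU 4Z≤NU =
  *-cancelʳ-≤ N (2 * ℓ) U (*-cancelˡ-≤ 2 (+-cancelˡ-≤ (2 * (N * U)) _ _ (begin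
    2 * (N * U) + 2 * (N * U)         ≡⟨ two-halves (N * U) ⟩
    4 * (N * U)                       ≤⟨ *-monoʳ-≤ 4 total ⟩
    4 * (C + Y + Z)                   ≡⟨ spread C Y Z ⟩
    4 * C + (4 * Y + 4 * Z)           ≤⟨ +-mono-≤ (*-monoʳ-≤ 4 C≤Uℓ) (+-mono-≤ 4Y≤NU 4Z≤NU) ⟩
    4 * (U * ℓ) + (N * U + N * U)     ≡⟨ rearrange N U ℓ ⟩
    2 * (N * U) + 2 * (2 * ℓ * U)     ∎)))
  where
  open ≤-Reasoning
  two-halves : ∀ x → 2 * x + 2 * x ≡ 4 * x
  two-halves = solve-∀
  spread : ∀ C Y Z → 4 * (C + Y + Z) ≡ 4 * C + (4 * Y + 4 * Z)
  spread = solve-∀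
  rearrange : ∀ N U ℓ → 4 * (U * ℓ) + (N * U + N * U) ≡ 2 * (N * U) + 2 * (2 * ℓ * U)
  rearrange = solve-∀

module CountingArgument {n q m : ℕ} (A : Algorithm n q (suc m)) (ℓ : ℕ) where

  Outcome : Set
  Outcome = Vec (Cube n) q × Fin (suc m)

  outcomes : List Outcome
  outcomes = cartesianProduct (allSeq n q) (allFin (suc m))

  length-outcomes : length outcomes ≡ (2 ^ n) ^ q * suc m
  length-outcomes = trans (length-cartesianProduct (allSeq n q) (allFin (suc m)))
                          (cong₂ _*_ (length-allSeq n q) (length-tabulate {n = suc m} (λ i → i)))

  outcomes-nonempty : 1 ≤ length outcomes
  outcomes-nonempty = ≤-trans (*-mono-≤ (≤-trans (≤-reflexive (sym (^-zeroˡ q))) (^-monoˡ-≤ q (m^n>0 2 n)))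
                                        (s≤s (z≤n {m})))
                              (≤-reflexive (sym length-outcomes))

  blindOutput : Outcome → Subset n
  blindOutput w = A (Vec.map (λ x → x , false) (proj₁ w)) (ones n) (proj₂ w)

  covers : Subset n → Outcome → Bool
  covers T w = andOn T (blindOutput w) ∧ (∣ blindOutput w ∣ ≤ᵇ ℓ)

  sees : Subset n → Outcome → Bool
  sees T w = anyAndOn T (proj₁ w)

  failuresOn : Subset n → ℕ
  failuresOn T = failures A (andOn T) ℓ (ones n)

  succeeds⇒covers : ∀ T w → sees T w ≡ false → Succeeds A (andOn T) ℓ (ones n) w → covers T w ≡ true
  succeeds⇒covers T (xs , r) unseen success =
    cong₂ _∧_ (certificate-of-ones T S cert) (Equivalence.to T-≡ (≤⇒≤ᵇ small))
    where
    S = blindOutput (xs , r)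
    blind-success : ∣ S ∣ ≤ ℓ × IsCertificate (andOn T) (ones n) S
    blind-success = subst (λ ex → ∣ A ex (ones n) r ∣ ≤ ℓ × IsCertificate (andOn T) (ones n) (A ex (ones n) r))
                          (labels-unseen T xs unseen) success
    small = proj₁ blind-success
    cert = proj₂ blind-success

  neither⇒fails : ∀ T w → covers T w ∨ sees T w ≡ false → ¬ Succeeds A (andOn T) ℓ (ones n) w
  neither⇒fails T w neither success with covers T w in uncovered | sees T w in unseen
  neither⇒fails T w refl success | false | false
    with () ← trans (sym uncovered) (succeeds⇒covers T w unseen success)

  outcomes≤covers+sees+failures : ∀ T →
    length outcomes ≤ count (covers T) outcomes + count (sees T) outcomes + failuresOn T
  outcomes≤covers+sees+failures T =
    ≤-trans (length≤count+filter (λ w → ¬? (succeeds? A (andOn T) ℓ (ones n) w))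
                                 (λ w → covers T w ∨ sees T w) (neither⇒fails T) outcomes)
            (+-monoˡ-≤ (failuresOn T) (count-∨ (covers T) (sees T) outcomes))

  4*sees≤outcomes : ∀ {k} T → ∣ T ∣ ≡ k → 4 * q < 2 ^ k → 4 * count (sees T) outcomes ≤ length outcomes
  4*sees≤outcomes {k} T refl 4q<2ᵏ = quarter-of-scaled {count (sees T) outcomes} {2 ^ k} {q} {length outcomes} (begin
      count (sees T) outcomes * 2 ^ k
    ≡⟨ cong (_* 2 ^ k) (count-cartesianProduct (anyAndOn T) (allSeq n q) (allFin (suc m))) ⟩
      count (anyAndOn T) (allSeq n q) * M * 2 ^ k
    ≡⟨ swap-last (count (anyAndOn T) (allSeq n q)) M (2 ^ k) ⟩
      count (anyAndOn T) (allSeq n q) * 2 ^ k * M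
    ≤⟨ *-monoˡ-≤ M (count-anyAndOn n q T) ⟩
      q * (2 ^ n) ^ q * M
    ≡⟨ *-assoc q _ M ⟩
      q * ((2 ^ n) ^ q * M)
    ≡⟨ cong (λ z → q * ((2 ^ n) ^ q * z)) (length-tabulate {n = suc m} (λ i → i)) ⟩
      q * ((2 ^ n) ^ q * suc m)
    ≡⟨ cong (q *_) length-outcomes ⟨
      q * length outcomes
    ∎) 4q<2ᵏ
    where
    open ≤-Reasoning
    M = length (allFin (suc m))
    swap-last : ∀ a b c → a * b * c ≡ a * c * b
    swap-last = solve-∀

  covers-total : (F : List (Subset n)) → (∀ S → count (λ T → andOn T S) F ≤ ∣ S ∣) →
    sumOver F (λ T → count (covers T) outcomes) ≤ length outcomes * ℓ
  covers-total F sparse = begin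
      sumOver F (λ T → count (covers T) outcomes)
    ≡⟨ sum-count-comm F outcomes covers ⟩
      sumOver outcomes (λ w → count (λ T → covers T w) F)
    ≤⟨ sum-mono-≤ outcomes (All.tabulate (λ {w} _ → covers≤ℓ w)) ⟩
      sumOver outcomes (λ _ → ℓ)
    ≡⟨ sum-const outcomes ℓ ⟩
      length outcomes * ℓ
    ∎
    where
    open ≤-Reasoning
    covered≤ℓ : ∀ S b → (𝔹.T b → ∣ S ∣ ≤ ℓ) → count (λ T → andOn T S ∧ b) F ≤ ℓ
    covered≤ℓ S true  small = ≤-trans (≤-reflexive (count-cong (λ T → ∧-identityʳ (andOn T S)) F))
                                      (≤-trans (sparse S) (small _))
    covered≤ℓ S false _     = ≤-trans (≤-reflexive (trans (count-cong (λ T → ∧-zeroʳ (andOn T S)) F)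
                                                          (count-false F)))
                                      z≤n
    covers≤ℓ : ∀ w → count (λ T → covers T w) F ≤ ℓ
    covers≤ℓ w = covered≤ℓ (blindOutput w) _ (≤ᵇ⇒≤ _ _)

  family-size-bound : ∀ {k} (F : List (Subset n)) → All (λ T → ∣ T ∣ ≡ k) F →
    (∀ S → count (λ T → andOn T S) F ≤ ∣ S ∣) → 4 * q < 2 ^ k →
    All (λ T → 4 * failuresOn T ≤ length outcomes) F → length F ≤ 2 * ℓ
  family-size-bound F sizes sparse 4q<2ᵏ rare-failures =
    averaging-bound {{>-nonZero outcomes-nonempty}} total (covers-total F sparse)
      (quarter-sum (All.map (λ ∣T∣≡k → 4*sees≤outcomes _ ∣T∣≡k 4q<2ᵏ) sizes)) (quarter-sum rare-failures)
    where
    open ≤-Reasoning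
    quarter-sum : ∀ {f : Subset n → ℕ} → All (λ T → 4 * f T ≤ length outcomes) F →
      4 * sumOver F f ≤ length F * length outcomes
    quarter-sum {f} bounds = begin
      4 * sumOver F f                   ≡⟨ sum-*ˡ F 4 f ⟨
      sumOver F (λ T → 4 * f T)         ≤⟨ sum-mono-≤ F bounds ⟩
      sumOver F (λ _ → length outcomes) ≡⟨ sum-const F _ ⟩
      length F * length outcomes        ∎
    total : length F * length outcomes ≤ sumOver F (λ T → count (covers T) outcomes)
                                         + sumOver F (λ T → count (sees T) outcomes)
                                         + sumOver F failuresOn
    total = begin
      length F * length outcomes        ≡⟨ sum-const F _ ⟨
      sumOver F (λ _ → length outcomes)
        ≤⟨ sum-mono-≤ F (All.tabulate (λ {T} _ → outcomes≤covers+sees+failures T)) ⟩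
      sumOver F (λ T → count (covers T) outcomes + count (sees T) outcomes + failuresOn T)
        ≡⟨ trans (sum-+ F _ _) (cong (_+ sumOver F failuresOn) (sum-+ F _ _)) ⟩
      sumOver F (λ T → count (covers T) outcomes) + sumOver F (λ T → count (sees T) outcomes)
        + sumOver F failuresOn          ∎

certificate-lower-bound : ∀ {n b ℓ q m a} → suc b ≤ ℓ → ℓ * 4 ≤ n → 1 ≤ a →
  (A : Algorithm n q (suc m)) →
  (∀ f → Monotone f → CertComplexity≤ f (suc b) → ∀ x⋆ → FailProb≤InvPow A f ℓ x⋆ a) →
  2 ^ suc b ≤ 4 * q
certificate-lower-bound {n} {b} {ℓ} {q} {m} {a} k≤ℓ 4ℓ≤n 1≤a A reliable with 2 ^ suc b ≤? 4 * q
... | yes 2ᵏ≤4q = 2ᵏ≤4q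
... | no  2ᵏ≰4q = ⊥-elim (≤⇒≯ (family-size-bound F (sunflower-size b n) (sunflower-sparse b n) (≰⇒> 2ᵏ≰4q)
                                                  (All.map (λ {T} → rare-failure {T}) (sunflower-size b n)))
                               (sunflower-large n k≤ℓ 4ℓ≤n))
  where
  open CountingArgument A ℓ
  F = sunflower b n
  4≤n : 4 ≤ n
  4≤n = ≤-trans (*-monoˡ-≤ 4 (≤-trans (s≤s z≤n) k≤ℓ)) 4ℓ≤n
  4≤nᵃ : 4 ≤ n ^ a
  4≤nᵃ = ≤-trans 4≤n (≤-trans (≤-reflexive (sym (^-identityʳ n)))
                              (^-monoʳ-≤ n {{>-nonZero (≤-trans (s≤s z≤n) 4≤n)}} 1≤a))
  rare-failure : ∀ {T} → ∣ T ∣ ≡ suc b → 4 * failuresOn T ≤ length outcomes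
  rare-failure {T} ∣T∣≡k = begin
    4 * failuresOn T       ≡⟨ *-comm 4 (failuresOn T) ⟩
    failuresOn T * 4       ≤⟨ *-monoʳ-≤ (failuresOn T) 4≤nᵃ ⟩
    failuresOn T * n ^ a   ≤⟨ reliable (andOn T) (andOn-monotone T) (andOn-certComplexity T ∣T∣≡k) (ones n) ⟩
    (2 ^ n) ^ q * suc m    ≡⟨ length-outcomes ⟨
    length outcomes        ∎
    where open ≤-Reasoning

claim8p6 : ∃ λ d → 1 ≤ d ×
    (∀ (a : ℕ) → 1 ≤ a → ∃ λ e → ∃ λ k₀ →
      ∀ (n k ℓ q m : ℕ) → k ≤ ℓ → ℓ * d ≤ n → k₀ ≤ k →
      (A : Algorithm n q (suc m)) →
      (∀ (f : BoolFun n) → Monotone f → CertComplexity≤ f k →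
        ∀ (x⋆ : Cube n) → FailProb≤InvPow A f ℓ x⋆ a) →
      2 ^ k ≤ e * q)
claim8p6 = 4 , s≤s z≤n , λ a 1≤a → 4 , 1 , λ where
  n (suc b) ℓ q m k≤ℓ 4ℓ≤n 1≤k A reliable → certificate-lower-bound k≤ℓ 4ℓ≤n 1≤a A reliable
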